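{- Let $r\ge 2$, let $G$ be a graph with $\chi(G)=k>r$, and let $m'(G)$ be the smallest $|Z|$ over all pairs $(U,Z)$ where $U\subseteq V(G)$ is an independent set and $Z\subseteq E(G)$ is a set of edges such that deleting the vertices of $U$ and the edges of $Z$ from $G$ results in a graph of chromatic number $k-2$. Let $s$ and $n$ be integers with $s\ge m'(G)-1$ and $n>s$. Let $\mathcal{G}_2$ be the $n$-vertex $r$-graph whose vertex set is the disjoint union of sets $A,B,C$ with $|A|=m'(G)-1$, $|B|=s-m'(G)+1$, $|C|=n-s$, where $\mathcal{G}_0$ is a complete $(k-2)$-partite $(r-1)$-graph on $C$, and whose hyperedges are the $r$-sets consisting of a vertex of $A$ and $r-1$ vertices of $C$, together with the $r$-sets consisting of a vertex of $B$ and a hyperedge of $\mathcal{G}_0$. Then $\mathcal{G}_2$ does not contain $G^r$ as a subhypergraph.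
   Context: For a graph $G$, its $r$-expansion $G^r$ is the $r$-graph obtained from $G$ by adding $r-2$ new vertices to each edge of $G$, all these $(r-2)|E(G)|$ new vertices being distinct from each other and from $V(G)$. A complete $\ell$-partite $(r-1)$-graph on a set $C$ (with respect to a partition of $C$ into $\ell$ parts) has as hyperedges all $(r-1)$-subsets of $C$ meeting each part in at most one vertex. -}

module Defs where

open import Data.Nat using (ℕ; _≤_; _<_; _∸_; _+_)
open import Data.Fin using (Fin; toℕ)
open import Data.Fin.Subset using (Subset; _∈_; _∉_; ⁅_⁆; _∪_; ∣_∣; ⊥)
open import Data.Product using (Σ; _×_; _,_; proj₁; proj₂; ∃; ∃-syntax)
open import Data.Sum using (_⊎_; inj₁; inj₂)
open import Data.List using (List; _∷_; []; map; foldr; allFin)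
open import Relation.Nullary using (¬_)
open import Data.Unit using (⊤)
open import Relation.Binary.PropositionalEquality using (_≡_; _≢_)
open import Function.Definitions using (Injective)

record Graph : Set where
  field
    nv   : ℕ
    ne   : ℕ
    ends : Fin ne → Fin nv × Fin nv
    loopless : ∀ e → proj₁ (ends e) ≢ proj₂ (ends e)
    simple   : ∀ e e' →
      ((proj₁ (ends e) ≡ proj₁ (ends e') × proj₂ (ends e) ≡ proj₂ (ends e'))
       ⊎ (proj₁ (ends e) ≡ proj₂ (ends e') × proj₂ (ends e) ≡ proj₁ (ends e')))
      → e ≡ e'

open Graph public

src tgt : (G : Graph) → Fin (ne G) → Fin (nv G)
src G e = proj₁ (ends G e)
tgt G e = proj₂ (ends G e)

-- Colourings of the subgraph of G induced by the vertices satisfying Vin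
-- and the edges satisfying Ein (Ein only selects edges whose ends are
-- both in Vin, in our uses).

Colorable : (G : Graph) → (Fin (nv G) → Set) → (Fin (ne G) → Set) → ℕ → Set
Colorable G Vin Ein c =
  Σ ((x : Fin (nv G)) → Vin x → Fin c) λ f →
    ∀ e → Ein e → (pu : Vin (src G e)) (pv : Vin (tgt G e)) →
      f (src G e) pu ≢ f (tgt G e) pv

HasChromaticNumber : (G : Graph) → (Fin (nv G) → Set) → (Fin (ne G) → Set) → ℕ → Set
HasChromaticNumber G Vin Ein c =
  Colorable G Vin Ein c × (∀ d → d < c → ¬ Colorable G Vin Ein d)

χ≡ : Graph → ℕ → Set
χ≡ G k = HasChromaticNumber G (λ _ → ⊤) (λ _ → ⊤) k

Independent : (G : Graph) → Subset (nv G) → Set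
Independent G U = ∀ e → ¬ (src G e ∈ U × tgt G e ∈ U)

DeletionChi : (G : Graph) → Subset (nv G) → Subset (ne G) → ℕ → Set
DeletionChi G U Z c =
  HasChromaticNumber G (λ x → x ∉ U)
    (λ e → (e ∉ Z) × (src G e ∉ U) × (tgt G e ∉ U)) c

IsMPrime : Graph → ℕ → ℕ → Set
IsMPrime G k m =
  (Σ (Subset (nv G)) λ U → Σ (Subset (ne G)) λ Z →
     Independent G U × DeletionChi G U Z (k ∸ 2) × ∣ Z ∣ ≡ m)
  × (∀ (U : Subset (nv G)) (Z : Subset (ne G)) →
       Independent G U → DeletionChi G U Z (k ∸ 2) → m ≤ ∣ Z ∣)

HyperGraph : ℕ → Set₁
HyperGraph N = Subset N → Set

fromList : ∀ {N} → List (Fin N) → Subset N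
fromList = foldr (λ x S → ⁅ x ⁆ ∪ S) ⊥

-- r-expansion G^r: vertex set V(G) ⊎ (E(G) × Fin (r-2)), the new vertices
-- (e , j) being the r-2 new vertices added to edge e.
ExpVertex : Graph → ℕ → Set
ExpVertex G r = Fin (nv G) ⊎ (Fin (ne G) × Fin (r ∸ 2))

expEdge : (G : Graph) (r : ℕ) → Fin (ne G) → List (ExpVertex G r)
expEdge G r e = inj₁ (src G e) ∷ inj₁ (tgt G e) ∷ map (λ j → inj₂ (e , j)) (allFin (r ∸ 2))

ContainsExpansion : ∀ {N} → HyperGraph N → Graph → ℕ → Set
ContainsExpansion {N} H G r =
  Σ (ExpVertex G r → Fin N) λ φ →
    Injective _≡_ _≡_ φ × (∀ e → H (fromList (map φ (expEdge G r e))))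

-- The construction 𝒢₂ on vertex set Fin n with parameters m (= m'(G)), s,
-- part sizes: A = {x | x < m-1}, B = {x | m-1 ≤ x < s}, C = {x | s ≤ x},
-- so |A| = m-1, |B| = s-m+1, |C| = n-s (when m-1 ≤ s < n).
-- p : the partition of C into k-2 parts (values of p outside C irrelevant).

InA InB InC : ∀ {n} → ℕ → ℕ → Fin n → Set
InA m s x = toℕ x < m ∸ 1
InB m s x = (m ∸ 1 ≤ toℕ x) × (toℕ x < s)
InC m s x = s ≤ toℕ x

G0Edge : ∀ {n ℓ} → ℕ → ℕ → ℕ → (Fin n → Fin ℓ) → Subset n → Set
G0Edge {n} r m s p T =
  (∀ y → y ∈ T → InC m s y) × ∣ T ∣ ≡ r ∸ 1 ×
  (∀ y z → y ∈ T → z ∈ T → y ≢ z → p y ≢ p z)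

IsPartitionOfC : ∀ {n ℓ} → ℕ → ℕ → (Fin n → Fin ℓ) → Set
IsPartitionOfC {n} {ℓ} m s p = ∀ (j : Fin ℓ) → ∃[ x ] (InC m s x × p x ≡ j)

G₂ : ∀ {n ℓ} → ℕ → ℕ → ℕ → (Fin n → Fin ℓ) → HyperGraph n
G₂ r m s p S =
  Σ _ λ x → Σ _ λ T → S ≡ ⁅ x ⁆ ∪ T ×
    ((InA m s x × (∀ y → y ∈ T → InC m s y) × ∣ T ∣ ≡ r ∸ 1)
     ⊎ (InB m s x × G0Edge r m s p T))

{-# OPTIONS --safe #-}
module Submission where

-- Let φ embed G^r in 𝒢₂. Every edge e of G is sent to a hyperedge with a single apex outside C,
-- all its other vertices lying in C. Let U be the vertices of G that φ sends outside C (so onto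
-- the apex of each incident edge) and Z the edges between vertices of V(G) ∖ U whose apex lies
-- in A. Two ends of an edge cannot both be the apex, so U is independent; for e ∈ Z the apex is
-- one of the r - 2 new vertices of e, so e ↦ apex is injective on Z and |Z| ≤ |A| = m'(G) - 1.
-- Every other edge of G - U has its apex in B, hence its ends in a hyperedge of 𝒢₀, hence in
-- different parts of C: the partition colours G - U - Z with k - 2 colours. Finally, deleting
-- an independent set lowers χ by at most one and restoring an edge raises it by at most one, so
-- some Z' ⊆ Z has χ(G - U - Z') = k - 2 exactly, giving m'(G) ≤ |Z'| ≤ m'(G) - 1; this is absurd
-- since m'(G) ≥ 1, once more because deleting an independent set lowers χ by at most one.

open import Defs
open import Data.Nat using (ℕ; zero; suc; z≤n; s≤s; _≤_; _<_; _∸_; _≤?_; _<?_)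
open import Data.Nat.Properties
  using (≤-trans; ≤-<-trans; n<1+n; <-≤-trans; <⇒≤; <⇒≱; n≮0; ∸-monoʳ-<)
open import Data.Fin using (Fin; zero; suc; toℕ; fromℕ; fromℕ<; inject₁; inject≤; _≟_)
open import Data.Fin.Properties
  using (injective⇒≤; toℕ-injective; toℕ-fromℕ<; suc-injective; inject≤-injective;
         inject₁-injective; fromℕ≢inject₁)
open import Data.Fin.Subset
  using (Subset; inside; outside; _∈_; _∉_; _⊆_; _⊂_; ⁅_⁆; _∪_; _-_; ∣_∣; ⊥)
open import Data.Fin.Subset.Properties
  using (_∈?_; ∉⊥; Empty-unique; ⊆-reflexive; x∈⁅x⁆; x∈⁅y⁆⇒x≡y; x∈p∪q⁺; x∈p∪q⁻; nonempty?;
         p─q⊆p; p⊆q⇒∣p∣≤∣q∣;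
         x∈p⇒p-x⊂p; x∈p⇒∣p-x∣<∣p∣; x∈p∧x≢y⇒x∈p-y)
open import Data.Fin.Subset.Induction using (Acc; acc; ⊂-wellFounded)
open import Data.Vec using (_∷_; here; there; tabulate)
open import Data.Vec.Properties using (lookup∘tabulate; lookup⇒[]=; []=⇒lookup)
open import Data.List using (List; []; _∷_; map)
open import Data.List.Relation.Unary.Any using (here; there)
open import Data.List.Membership.Propositional using () renaming (_∈_ to _∈ₗ_)
open import Data.List.Membership.Propositional.Properties using (∈-map⁻)
open import Data.Product using (∃; _×_; _,_; proj₁; proj₂)
open import Data.Sum using (_⊎_; inj₁; inj₂)
open import Data.Sum.Properties using (inj₁-injective; inj₂-injective)
open import Data.Empty using (⊥-elim)
open import Data.Unit using (⊤)
open import Function using (_∘_; id)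
open import Function.Definitions using (Injective)
open import Relation.Nullary using (¬_; Dec; yes; no; does)
open import Relation.Nullary.Decidable using (¬?; _×-dec_; dec-true; decidable-stable)
open import Relation.Unary using (Decidable)
open import Relation.Binary.PropositionalEquality using (_≡_; _≢_; refl; sym; trans; cong; subst)

module _ {n : ℕ} {P : Fin n → Set} (P? : Decidable P) where

  satisfying : Subset n
  satisfying = tabulate (does ∘ P?)

  ∈-satisfying⁺ : ∀ {x} → P x → x ∈ satisfying
  ∈-satisfying⁺ {x} px = lookup⇒[]= x _ (trans (lookup∘tabulate (does ∘ P?) x) (dec-true (P? x) px))

  ∈-satisfying⁻ : ∀ {x} → x ∈ satisfying → P x
  ∈-satisfying⁻ {x} x∈ with P? x | trans (sym (lookup∘tabulate (does ∘ P?) x)) ([]=⇒lookup x∈)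
  ... | yes px | _ = px
  ... | no _   | ()

enumerate : ∀ {n} (p : Subset n) → Fin ∣ p ∣ → Fin n
enumerate (inside  ∷ p) zero    = zero
enumerate (inside  ∷ p) (suc i) = suc (enumerate p i)
enumerate (outside ∷ p) i       = suc (enumerate p i)

enumerate-∈ : ∀ {n} (p : Subset n) i → enumerate p i ∈ p
enumerate-∈ (inside  ∷ p) zero    = here
enumerate-∈ (inside  ∷ p) (suc i) = there (enumerate-∈ p i)
enumerate-∈ (outside ∷ p) i       = there (enumerate-∈ p i)

enumerate-injective : ∀ {n} (p : Subset n) → Injective _≡_ _≡_ (enumerate p)
enumerate-injective (inside  ∷ p) {zero}  {zero}  _  = refl
enumerate-injective (inside  ∷ p) {suc i} {suc j} eq =
  cong suc (enumerate-injective p (suc-injective eq))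
enumerate-injective (outside ∷ p) eq = enumerate-injective p (suc-injective eq)

injectiveOn⇒∣p∣≤ : ∀ {n N a} {p : Subset n} (f : Fin n → Fin N) →
  (∀ {x} → x ∈ p → toℕ (f x) < a) →
  (∀ {x y} → x ∈ p → y ∈ p → f x ≡ f y → x ≡ y) →
  ∣ p ∣ ≤ a
injectiveOn⇒∣p∣≤ {a = a} {p} f f<a f-inj = injective⇒≤ {f = f′} f′-injective
  where
  f′ : Fin ∣ p ∣ → Fin a
  f′ i = fromℕ< (f<a (enumerate-∈ p i))

  f′-injective : Injective _≡_ _≡_ f′
  f′-injective {i} {j} eq = enumerate-injective p (f-inj (enumerate-∈ p i) (enumerate-∈ p j)
    (toℕ-injective (trans (sym (toℕ-fromℕ< _)) (trans (cong toℕ eq) (toℕ-fromℕ< _)))))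

∈-fromList⁺ : ∀ {n} {x : Fin n} (xs : List (Fin n)) → x ∈ₗ xs → x ∈ fromList xs
∈-fromList⁺ (x ∷ _)  (here refl) = x∈p∪q⁺ (inj₁ (x∈⁅x⁆ x))
∈-fromList⁺ (_ ∷ xs) (there x∈)  = x∈p∪q⁺ (inj₂ (∈-fromList⁺ xs x∈))

∈-fromList⁻ : ∀ {n} {x : Fin n} (xs : List (Fin n)) → x ∈ fromList xs → x ∈ₗ xs
∈-fromList⁻ []       x∈ = ⊥-elim (∉⊥ x∈)
∈-fromList⁻ (y ∷ xs) x∈ with x∈p∪q⁻ ⁅ y ⁆ (fromList xs) x∈
... | inj₁ x∈⁅y⁆ = here (x∈⁅y⁆⇒x≡y y x∈⁅y⁆)
... | inj₂ x∈xs  = there (∈-fromList⁻ xs x∈xs)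

module _ {d : ℕ} where

  withFresh : ∀ {A : Set} → Dec A → (¬ A → Fin d) → Fin (suc d)
  withFresh (yes _) _ = fromℕ d
  withFresh (no ¬a) i = inject₁ (i ¬a)

  withFresh-≢ : ∀ {A B : Set} (a? : Dec A) (b? : Dec B) {i : ¬ A → Fin d} {j : ¬ B → Fin d} →
    ¬ (A × B) → (∀ ¬a ¬b → i ¬a ≢ j ¬b) → withFresh a? i ≢ withFresh b? j
  withFresh-≢ (yes a)  (yes b)  ¬a×b _  = λ _ → ¬a×b (a , b)
  withFresh-≢ (yes _)  (no _)   _    _  = fromℕ≢inject₁
  withFresh-≢ (no _)   (yes _)  _    _  = fromℕ≢inject₁ ∘ sym
  withFresh-≢ (no ¬a)  (no ¬b)  _    i≢j = i≢j ¬a ¬b ∘ inject₁-injective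

module Deletion (G : Graph) (U : Subset (nv G)) where

  Kept : Subset (ne G) → Fin (ne G) → Set
  Kept Z e = (e ∉ Z) × (src G e ∉ U) × (tgt G e ∉ U)

  ColorableWithout : Subset (ne G) → ℕ → Set
  ColorableWithout Z = Colorable G (_∉ U) (Kept Z)

  colorable-≤ : ∀ {Z c d} → c ≤ d → ColorableWithout Z c → ColorableWithout Z d
  colorable-≤ c≤d (f , f-proper) =
    (λ x x∉U → inject≤ (f x x∉U) c≤d) ,
    λ e kept su tu → f-proper e kept su tu ∘ inject≤-injective c≤d c≤d _ _

  colorable-⊆ : ∀ {Z₁ Z₂ c} → Z₁ ⊆ Z₂ → ColorableWithout Z₁ c → ColorableWithout Z₂ c
  colorable-⊆ Z₁⊆Z₂ (f , f-proper) = f , λ e (e∉Z₂ , ends∉U) → f-proper e (e∉Z₂ ∘ Z₁⊆Z₂ , ends∉U)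

  colorable-restore : ∀ {Z c} e → ColorableWithout Z c → ColorableWithout (Z - e) (suc c)
  colorable-restore {Z} {c} e (f , f-proper) = f′ , f′-proper
    where
    f′ : (x : Fin (nv G)) → x ∉ U → Fin (suc c)
    f′ x x∉U = withFresh (x ≟ src G e) (λ _ → f x x∉U)

    f′-proper : ∀ e′ → Kept (Z - e) e′ → (su : src G e′ ∉ U) (tu : tgt G e′ ∉ U) →
      f′ (src G e′) su ≢ f′ (tgt G e′) tu
    f′-proper e′ (e′∉Z-e , ends∉U) su tu =
      withFresh-≢ (src G e′ ≟ src G e) (tgt G e′ ≟ src G e)
        (λ (s≡ , t≡) → loopless G e′ (trans s≡ (sym t≡)))
        (λ s≢ _ → f-proper e′ (e′∉Z s≢ , ends∉U) su tu)
      where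
      e′∉Z : src G e′ ≢ src G e → e′ ∉ Z
      e′∉Z s≢ e′∈Z = e′∉Z-e (x∈p∧x≢y⇒x∈p-y e′∈Z λ { refl → s≢ refl })

  -- A fresh colour on the independent set U extends a colouring of G - U to G.
  independent⇒¬colorable : ∀ {c} → χ≡ G (suc (suc c)) → Independent G U → ¬ ColorableWithout ⊥ c
  independent⇒¬colorable {c} (_ , χ-minimal) U-independent (f , f-proper) =
    χ-minimal (suc c) (n<1+n (suc c)) (F , F-proper)
    where
    F : Fin (nv G) → ⊤ → Fin (suc c)
    F x _ = withFresh (x ∈? U) (f x)

    F-proper : ∀ e _ su tu → F (src G e) su ≢ F (tgt G e) tu
    F-proper e _ _ _ = withFresh-≢ (src G e ∈? U) (tgt G e ∈? U) (U-independent e)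
      (λ su tu → f-proper e (∉⊥ , su , tu) su tu)

  -- Whether G - U - Z needs fewer than c colours is not decidable here, so a colouring with
  -- d < c colours is refuted instead by recursing on Z - e, which it turns into one with d + 1 ≤ c.
  colorable⇒¬¬DeletionChi : ∀ {c} → ¬ ColorableWithout ⊥ c → ∀ {Z} → ColorableWithout Z c →
    ¬ ¬ ∃ λ Z′ → Z′ ⊆ Z × DeletionChi G U Z′ c
  colorable⇒¬¬DeletionChi {c} ¬colorable-⊥ = go (⊂-wellFounded _)
    where
    go : ∀ {Z} → Acc _⊂_ Z → ColorableWithout Z c → ¬ ¬ ∃ λ Z′ → Z′ ⊆ Z × DeletionChi G U Z′ c
    go {Z} (acc smaller) colorable none = none (Z , id , colorable , minimal)
      where
      minimal : ∀ d → d < c → ¬ ColorableWithout Z d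
      minimal d d<c colorable-d with nonempty? Z
      ... | no Z-empty =
        ¬colorable-⊥ (colorable-⊆ (⊆-reflexive (Empty-unique Z-empty))
                                  (colorable-≤ (<⇒≤ d<c) colorable-d))
      ... | yes (e , e∈Z) =
        go (smaller (x∈p⇒p-x⊂p e∈Z)) (colorable-≤ d<c (colorable-restore e colorable-d))
          λ (Z′ , Z′⊆Z-e , χZ′) → none (Z′ , p─q⊆p Z ⁅ e ⁆ ∘ Z′⊆Z-e , χZ′)

IsMPrime⇒0<m : ∀ {G c m} → χ≡ G (suc (suc c)) → IsMPrime G (suc (suc c)) m → 0 < m
IsMPrime⇒0<m {G} χG ((U , Z , U-independent , (colorable , _) , refl) , _) with nonempty? Z
... | yes (e , e∈Z) = ≤-<-trans z≤n (x∈p⇒∣p-x∣<∣p∣ e∈Z)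
... | no Z-empty = ⊥-elim (independent⇒¬colorable χG U-independent
                           (colorable-⊆ (⊆-reflexive (Empty-unique Z-empty)) colorable))
  where open Deletion G U

IsMPrime⇒m≤∣Z∣ : ∀ {G c m U Z} → χ≡ G (suc (suc c)) → IsMPrime G (suc (suc c)) m →
  Independent G U → Deletion.ColorableWithout G U Z c → m ≤ ∣ Z ∣
IsMPrime⇒m≤∣Z∣ {G} {m = m} {U} {Z} χG (_ , m-minimal) U-independent colorable =
  decidable-stable (m ≤? ∣ Z ∣) λ m≰∣Z∣ →
    colorable⇒¬¬DeletionChi (independent⇒¬colorable χG U-independent) colorable
      λ (Z′ , Z′⊆Z , χZ′) → m≰∣Z∣ (≤-trans (m-minimal U Z′ U-independent χZ′) (p⊆q⇒∣p∣≤∣q∣ Z′⊆Z))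
  where open Deletion G U

InA? : ∀ {n} m s → Decidable (InA {n} m s)
InA? m s x = toℕ x <? m ∸ 1

InC? : ∀ {n} m s → Decidable (InC {n} m s)
InC? m s x = s ≤? toℕ x

module Hyperedge {r m s n ℓ} {p : Fin n → Fin ℓ} (m∸1≤s : m ∸ 1 ≤ s)
                 {S : Subset n} (S-edge : G₂ r m s p S) where

  apex : Fin n
  apex = proj₁ S-edge

  base : Subset n
  base = proj₁ (proj₂ S-edge)

  private
    S≡apex∪base : S ≡ ⁅ apex ⁆ ∪ base
    S≡apex∪base = proj₁ (proj₂ (proj₂ S-edge))

    shape : (InA m s apex × (∀ y → y ∈ base → InC m s y) × ∣ base ∣ ≡ r ∸ 1)
            ⊎ (InB m s apex × G0Edge r m s p base)
    shape = proj₂ (proj₂ (proj₂ S-edge))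

  apex-∉C : ¬ InC m s apex
  apex-∉C with shape
  ... | inj₁ (apex∈A , _)        = <⇒≱ (<-≤-trans apex∈A m∸1≤s)
  ... | inj₂ ((_ , apex<s) , _) = <⇒≱ apex<s

  base⊆C : ∀ {y} → y ∈ base → InC m s y
  base⊆C with shape
  ... | inj₁ (_ , base⊆C′ , _)       = base⊆C′ _
  ... | inj₂ (_ , (base⊆C′ , _ , _)) = base⊆C′ _

  apex-∈ : apex ∈ S
  apex-∈ = subst (apex ∈_) (sym S≡apex∪base) (x∈p∪q⁺ (inj₁ (x∈⁅x⁆ apex)))

  apex∉A⇒G0Edge : ¬ InA m s apex → G0Edge r m s p base
  apex∉A⇒G0Edge apex∉A with shape
  ... | inj₁ (apex∈A , _) = ⊥-elim (apex∉A apex∈A)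
  ... | inj₂ (_ , G0-edge) = G0-edge

  private
    ∈-apex∪base : ∀ {y} → y ∈ S → y ≡ apex ⊎ y ∈ base
    ∈-apex∪base y∈S with x∈p∪q⁻ ⁅ apex ⁆ base (subst (_ ∈_) S≡apex∪base y∈S)
    ... | inj₁ y∈⁅apex⁆ = inj₁ (x∈⁅y⁆⇒x≡y apex y∈⁅apex⁆)
    ... | inj₂ y∈base   = inj₂ y∈base

  ∈∖C⇒≡apex : ∀ {y} → y ∈ S → ¬ InC m s y → y ≡ apex
  ∈∖C⇒≡apex y∈S y∉C with ∈-apex∪base y∈S
  ... | inj₁ y≡apex = y≡apex
  ... | inj₂ y∈base = ⊥-elim (y∉C (base⊆C y∈base))

  ∈C⇒∈base : ∀ {y} → y ∈ S → InC m s y → y ∈ base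
  ∈C⇒∈base y∈S y∈C with ∈-apex∪base y∈S
  ... | inj₁ refl   = ⊥-elim (apex-∉C y∈C)
  ... | inj₂ y∈base = y∈base

module Embedding {r m s n ℓ} (G : Graph) {p : Fin n → Fin ℓ} (m∸1≤s : m ∸ 1 ≤ s)
  (φ : ExpVertex G r → Fin n) (φ-injective : Injective _≡_ _≡_ φ)
  (φ-edge : ∀ e → G₂ r m s p (fromList (map φ (expEdge G r e)))) where

  module Image (e : Fin (ne G)) = Hyperedge {r} {m} m∸1≤s (φ-edge e)
  open Image using (apex)

  src-∈ : ∀ e → φ (inj₁ (src G e)) ∈ fromList (map φ (expEdge G r e))
  src-∈ e = ∈-fromList⁺ (map φ (expEdge G r e)) (here refl)

  tgt-∈ : ∀ e → φ (inj₁ (tgt G e)) ∈ fromList (map φ (expEdge G r e))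
  tgt-∈ e = ∈-fromList⁺ (map φ (expEdge G r e)) (there (here refl))

  MappedOutsideC? : Decidable (λ v → ¬ InC m s (φ (inj₁ v)))
  MappedOutsideC? v = ¬? (InC? m s (φ (inj₁ v)))

  U : Subset (nv G)
  U = satisfying MappedOutsideC?

  ∉U⇒∈C : ∀ {v} → v ∉ U → InC m s (φ (inj₁ v))
  ∉U⇒∈C v∉U = decidable-stable (InC? m s _) (v∉U ∘ ∈-satisfying⁺ MappedOutsideC?)

  U-independent : Independent G U
  U-independent e (src∈U , tgt∈U) = loopless G e (inj₁-injective (φ-injective
    (trans (Image.∈∖C⇒≡apex e (src-∈ e) (∈-satisfying⁻ MappedOutsideC? src∈U))
      (sym (Image.∈∖C⇒≡apex e (tgt-∈ e) (∈-satisfying⁻ MappedOutsideC? tgt∈U))))))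

  ApexInAEndsOutsideU? : Decidable (λ e → InA m s (apex e) × src G e ∉ U × tgt G e ∉ U)
  ApexInAEndsOutsideU? e = InA? m s (apex e) ×-dec ¬? (src G e ∈? U) ×-dec ¬? (tgt G e ∈? U)

  Z : Subset (ne G)
  Z = satisfying ApexInAEndsOutsideU?

  apex-new : ∀ {e} → e ∈ Z → ∃ λ j → apex e ≡ φ (inj₂ (e , j))
  apex-new {e} e∈Z with ∈-satisfying⁻ ApexInAEndsOutsideU? e∈Z
  ... | (_ , src∉U , tgt∉U)
    with ∈-map⁻ φ (∈-fromList⁻ (map φ (expEdge G r e)) (Image.apex-∈ e))
  ... | _ , here refl , apex≡ =
    ⊥-elim (Image.apex-∉C e (subst (InC m s) (sym apex≡) (∉U⇒∈C src∉U)))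
  ... | _ , there (here refl) , apex≡ =
    ⊥-elim (Image.apex-∉C e (subst (InC m s) (sym apex≡) (∉U⇒∈C tgt∉U)))
  ... | _ , there (there w∈new) , apex≡ with ∈-map⁻ (λ j → inj₂ (e , j)) w∈new
  ...   | j , _ , refl = j , apex≡

  apex-injectiveOn-Z : ∀ {e e′} → e ∈ Z → e′ ∈ Z → apex e ≡ apex e′ → e ≡ e′
  apex-injectiveOn-Z e∈Z e′∈Z apex≡apex′ with apex-new e∈Z | apex-new e′∈Z
  ... | j , apex≡ | j′ , apex′≡ =
    cong proj₁ (inj₂-injective (φ-injective (trans (sym apex≡) (trans apex≡apex′ apex′≡))))

  ∣Z∣≤m∸1 : ∣ Z ∣ ≤ m ∸ 1
  ∣Z∣≤m∸1 = injectiveOn⇒∣p∣≤ apex (proj₁ ∘ ∈-satisfying⁻ ApexInAEndsOutsideU?) apex-injectiveOn-Z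

  open Deletion G U

  part∘φ-colorable : ColorableWithout Z ℓ
  part∘φ-colorable = (λ v _ → p (φ (inj₁ v))) , proper
    where
    proper : ∀ e → Kept Z e → (su : src G e ∉ U) (tu : tgt G e ∉ U) →
      p (φ (inj₁ (src G e))) ≢ p (φ (inj₁ (tgt G e)))
    proper e (e∉Z , src∉U , tgt∉U) _ _ =
      parts-distinct _ _ (Image.∈C⇒∈base e (src-∈ e) (∉U⇒∈C src∉U))
        (Image.∈C⇒∈base e (tgt-∈ e) (∉U⇒∈C tgt∉U)) (loopless G e ∘ inj₁-injective ∘ φ-injective)
      where
      apex∉A : ¬ InA m s (apex e)
      apex∉A apex∈A = e∉Z (∈-satisfying⁺ ApexInAEndsOutsideU? (apex∈A , src∉U , tgt∉U))

      parts-distinct : ∀ y z → y ∈ Image.base e → z ∈ Image.base e → y ≢ z → p y ≢ p z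
      parts-distinct = proj₂ (proj₂ (Image.apex∉A⇒G0Edge e apex∉A))

proposition4p2 : (r k : ℕ) (G : Graph) → 2 ≤ r → χ≡ G k → r < k →
    (m : ℕ) → IsMPrime G k m →
    (s n : ℕ) → m ∸ 1 ≤ s → s < n →
    (p : Fin n → Fin (k ∸ 2)) → IsPartitionOfC m s p →
    ¬ ContainsExpansion (G₂ r m s p) G r
proposition4p2 r zero G _ _ ()
proposition4p2 .(suc (suc _)) (suc zero) G (s≤s (s≤s _)) _ (s≤s ())
proposition4p2 r (suc (suc c)) G _ χG _ m m-is-m′ s n m∸1≤s _ p _ (φ , φ-injective , φ-edge) =
  <⇒≱ m∸1<m (≤-trans m≤∣Z∣ ∣Z∣≤m∸1)
  where
  open Embedding {r} {m} G m∸1≤s φ φ-injective φ-edge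

  m≤∣Z∣ : m ≤ ∣ Z ∣
  m≤∣Z∣ = IsMPrime⇒m≤∣Z∣ {G} {c} {Z = Z} χG m-is-m′ U-independent part∘φ-colorable

  m∸1<m : m ∸ 1 < m
  m∸1<m = ∸-monoʳ-< {o = 0} (s≤s z≤n) (IsMPrime⇒0<m {G} {c} χG m-is-m′)
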